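{- Let $g(n,1)$ denote the number of permutations $\pi\in S_n$ such that $\gamma(G_\pi)=1$, and for $m\ge 0$ let $f(m,1,0)=m!-g(m,1)$. Then $g(0,1)=0$ and, for every $n\ge 1$, \[ g(n,1)=\sum_{k=1}^{n}(n-k)!\,f(k-1,1,0). \]
   Context: For a permutation $\pi$ of $[n]=\{1,\dots,n\}$ (written in one-line notation $[\pi(1),\dots,\pi(n)]$), the permutation graph $G_\pi$ has vertex set $[n]$ and an edge between $i<j$ if and only if $\pi^{ -1}(i)>\pi^{ -1}(j)$. A set $D$ of vertices dominates a graph $G$ if every vertex is in $D$ or adjacent to a vertex of $D$; the domination number $\gamma(G)$ is the minimum size of a dominating set. Counts of "permutation graphs on $n$ vertices" with a property are counts of permutations $\pi\in S_n$ whose graph $G_\pi$ has that property. Thus $f(m,1,0)$ is the number of $\pi\in S_m$ such that $G_\pi$ has no dominating set of size one (with $f(0,1,0)=1$). -}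

module Defs where

open import Data.Nat using (ℕ; zero; suc; _+_; _*_; _∸_; _<_; _>_; _!)

open import Data.Fin using (Fin; toℕ; _≟_)
open import Data.Fin.Properties using (any?; all?)
open import Data.Vec using (Vec; lookup; []; _∷_)
open import Data.List using (List; []; _∷_; length; filter; map; concatMap; allFin; upTo)
open import Data.Nat.ListAction using (sum)
open import Data.Product using (_×_; ∃)
open import Data.Sum using (_⊎_)
open import Relation.Binary.PropositionalEquality using (_≡_)
open import Relation.Nullary using (Dec; ¬_)
open import Relation.Nullary.Decidable using (_→-dec_; _⊎-dec_; _×-dec_; ¬?)
import Data.Nat as ℕ

allVecs : (n k : ℕ) → List (Vec (Fin n) k)
allVecs n zero    = [] ∷ []
allVecs n (suc k) = concatMap (λ x → map (x ∷_) (allVecs n k)) (allFin n)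

IsPerm : ∀ {n} → Vec (Fin n) n → Set
IsPerm {n} π = ∀ (p q : Fin n) → lookup π p ≡ lookup π q → p ≡ q

isPerm? : ∀ {n} (π : Vec (Fin n) n) → Dec (IsPerm π)
isPerm? {n} π = all? λ p → all? λ q → (lookup π p ≟ lookup π q) →-dec (p ≟ q)

perms : (n : ℕ) → List (Vec (Fin n) n)
perms n = filter isPerm? (allVecs n n)

-- Edge of the permutation graph G_π between vertices i and j (vertex = value,
-- Fin n standing for [n] shifted by one): writing a = π⁻¹(i), b = π⁻¹(j)
-- (so lookup π a ≡ i, lookup π b ≡ j), the edge exists iff i < j and a > b,
-- or symmetrically j < i and b > a.
Edge : ∀ {n} → Vec (Fin n) n → Fin n → Fin n → Set
Edge {n} π i j =
  ∃ λ (a : Fin n) → ∃ λ (b : Fin n) →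
    lookup π a ≡ i × lookup π b ≡ j ×
    ((toℕ i < toℕ j × toℕ a > toℕ b) ⊎ (toℕ j < toℕ i × toℕ b > toℕ a))

edge? : ∀ {n} (π : Vec (Fin n) n) (i j : Fin n) → Dec (Edge π i j)
edge? {n} π i j =
  any? λ a → any? λ b →
    (lookup π a ≟ i) ×-dec (lookup π b ≟ j) ×-dec
    (((toℕ i ℕ.<? toℕ j) ×-dec (toℕ b ℕ.<? toℕ a)) ⊎-dec
     ((toℕ j ℕ.<? toℕ i) ×-dec (toℕ a ℕ.<? toℕ b)))

Dominates1 : ∀ {n} → Vec (Fin n) n → Fin n → Set
Dominates1 {n} π v = ∀ (u : Fin n) → u ≡ v ⊎ Edge π v u

-- γ(G_π) = 1, i.e. G_π has a dominating set of size one
-- (for n ≥ 1, γ ≥ 1 always; for n = 0 the empty set dominates, γ = 0).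
Gamma1 : ∀ {n} → Vec (Fin n) n → Set
Gamma1 {n} π = ∃ λ (v : Fin n) → Dominates1 π v

gamma1? : ∀ {n} (π : Vec (Fin n) n) → Dec (Gamma1 π)
gamma1? {n} π = any? λ v → all? λ u → (u ≟ v) ⊎-dec edge? π v u

g1 : ℕ → ℕ
g1 n = length (filter gamma1? (perms n))

f10 : ℕ → ℕ
f10 m = (m !) ∸ g1 m

rhs : ℕ → ℕ
rhs n = sum (map (λ i → ((n ∸ suc i) !) * f10 i) (upTo n))

module Submission where

-- In one-line notation (values 0,…,n-1) the vertex at position p
-- dominates G_π iff every entry before p is larger and every entry after p
-- is smaller than the entry at p; by pigeonhole that entry must be n-1-p.
-- Cutting π at its first dominating position p = k-1 leaves a prefix which,
-- lowered by n-p, is a permutation of length k-1 with no dominating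
-- position, and a suffix which is an arbitrary permutation of length n-k.
-- Conversely every such pair reassembles into a permutation whose first
-- dominating position is p, so exactly f(k-1,1,0)·(n-k)! permutations have
-- their first dominating position at k-1.

open import Defs
open import Data.Nat using (ℕ; zero; suc; _+_; _*_; _∸_; _<_; _≤_; z≤n; s≤s; s≤s⁻¹; _<?_; pred; _!)
open import Data.Nat.Properties
open import Data.Nat.ListAction using (sum)
open import Data.Fin as Fin using (Fin; toℕ; fromℕ<)
open import Data.Fin.Properties using (toℕ-injective; toℕ<n; toℕ-fromℕ<)
import Data.Fin.Properties as Finₚ
open import Data.Vec using (Vec; []; _∷_; lookup)
import Data.Vec.Properties as Vec
open import Data.List using (List; []; _∷_; length; map; filter; concatMap; _++_; take; drop; upTo)
open import Data.List.Properties using (∷-injective; length-map; length-++; length-take; length-drop; length-upTo; length-removeAt′; map-∘; map-id-local; map-cong)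
open import Data.List.Membership.Propositional using (_∈_)
open import Data.List.Membership.Propositional.Properties using (∈-map⁺; ∈-map⁻; ∈-++⁺ˡ; ∈-++⁺ʳ; ∈-++⁻; ∈-filter⁺; ∈-filter⁻; ∈-upTo⁺; ∈-upTo⁻; ∈-allFin)
open import Data.List.Relation.Unary.Any using (here; there; index; _─_)
open import Data.List.Relation.Unary.All as All using (All; []; _∷_)
import Data.List.Relation.Unary.All.Properties as AllP
open import Data.List.Relation.Unary.AllPairs using ([]; _∷_)
open import Data.List.Relation.Unary.Unique.Propositional using (Unique)
import Data.List.Relation.Unary.Unique.Propositional.Properties as Unique
open import Data.Product using (_×_; _,_; proj₁; proj₂; ∃; ∃₂)
open import Data.Sum using (_⊎_; inj₁; inj₂)
open import Data.Empty using (⊥; ⊥-elim)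
open import Function using (_∘_)
open import Relation.Binary.PropositionalEquality
open import Relation.Binary.Definitions using (tri<; tri≈; tri>)
open import Relation.Nullary using (¬_; yes; no; Dec)
open import Relation.Nullary.Decidable using (_×-dec_; _→-dec_; ¬?; dec-yes; dec-no)
open import Relation.Unary using (Decidable)

-- Counting by bijection

∈-─ : ∀ {A : Set} {x y : A} {ys : List A} (x∈ys : x ∈ ys) → y ∈ ys → y ≢ x → y ∈ (ys ─ x∈ys)
∈-─ (here refl) (here refl) y≢x = ⊥-elim (y≢x refl)
∈-─ (here refl) (there y∈ys) _ = y∈ys
∈-─ (there _) (here refl) _ = here refl
∈-─ (there x∈ys) (there y∈ys) y≢x = there (∈-─ x∈ys y∈ys y≢x)

unique-⊆⇒length-≤ : ∀ {A : Set} {xs ys : List A} →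
  Unique xs → (∀ {x} → x ∈ xs → x ∈ ys) → length xs ≤ length ys
unique-⊆⇒length-≤ {xs = []} _ _ = z≤n
unique-⊆⇒length-≤ {xs = x ∷ xs} {ys} (x∉xs ∷ xs!) xs⊆ys = begin
  suc (length xs)          ≤⟨ s≤s (unique-⊆⇒length-≤ xs! xs⊆ys─x) ⟩
  suc (length (ys ─ x∈ys)) ≡⟨ sym (length-removeAt′ ys (index x∈ys)) ⟩
  length ys                ∎
  where
  open ≤-Reasoning
  x∈ys : x ∈ ys
  x∈ys = xs⊆ys (here refl)
  xs⊆ys─x : ∀ {y} → y ∈ xs → y ∈ (ys ─ x∈ys)
  xs⊆ys─x y∈xs = ∈-─ x∈ys (xs⊆ys (there y∈xs)) (λ y≡x → All.lookup x∉xs y∈xs (sym y≡x))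

map-unique : ∀ {A B : Set} (f : A → B) {xs : List A} → Unique xs →
  (∀ {a b} → a ∈ xs → b ∈ xs → f a ≡ f b → a ≡ b) → Unique (map f xs)
map-unique f {[]} [] _ = []
map-unique f {x ∷ xs} (x∉xs ∷ xs!) inj =
  All.tabulate fx∉ ∷ map-unique f xs! (λ a∈ b∈ → inj (there a∈) (there b∈))
  where
  fx∉ : ∀ {y} → y ∈ map f xs → f x ≢ y
  fx∉ y∈ fx≡y with ∈-map⁻ f y∈
  ... | z , z∈xs , y≡fz = All.lookup x∉xs z∈xs (inj (here refl) (there z∈xs) (trans fx≡y y≡fz))

record Enumerates {A : Set} (P : A → Set) (xs : List A) : Set where
  field
    unique   : Unique xs
    sound    : ∀ {x} → x ∈ xs → P x
    complete : ∀ {x} → P x → x ∈ xs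
open Enumerates

enumerates-≤ : ∀ {A B : Set} {P : A → Set} {Q : B → Set} {xs ys} →
  Enumerates P xs → Enumerates Q ys → (f : A → B) →
  (∀ {x} → P x → Q (f x)) → (∀ {x y} → P x → P y → f x ≡ f y → x ≡ y) →
  length xs ≤ length ys
enumerates-≤ {xs = xs} {ys} P-xs Q-ys f f-into f-inj = begin
  length xs         ≡⟨ sym (length-map f xs) ⟩
  length (map f xs) ≤⟨ unique-⊆⇒length-≤ fxs! fxs⊆ys ⟩
  length ys         ∎
  where
  open ≤-Reasoning
  fxs! : Unique (map f xs)
  fxs! = map-unique f (unique P-xs) (λ a∈ b∈ → f-inj (sound P-xs a∈) (sound P-xs b∈))
  fxs⊆ys : ∀ {y} → y ∈ map f xs → y ∈ ys
  fxs⊆ys y∈ with ∈-map⁻ f y∈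
  ... | x , x∈xs , refl = complete Q-ys (f-into (sound P-xs x∈xs))

enumerates-≡ : ∀ {A B : Set} {P : A → Set} {Q : B → Set} {xs ys} →
  Enumerates P xs → Enumerates Q ys → (f : A → B) (g : B → A) →
  (∀ {x} → P x → Q (f x)) → (∀ {y} → Q y → P (g y)) →
  (∀ {x} → P x → g (f x) ≡ x) → (∀ {y} → Q y → f (g y) ≡ y) →
  length xs ≡ length ys
enumerates-≡ P-xs Q-ys f g f-into g-into gf fg = ≤-antisym
  (enumerates-≤ P-xs Q-ys f f-into (λ px py e → trans (sym (gf px)) (trans (cong g e) (gf py))))
  (enumerates-≤ Q-ys P-xs g g-into (λ qx qy e → trans (sym (fg qx)) (trans (cong f e) (fg qy))))

enumerates-filter : ∀ {A : Set} {P Q : A → Set} {xs} → Enumerates P xs → (Q? : Decidable Q) →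
  Enumerates (λ x → P x × Q x) (filter Q? xs)
enumerates-filter P-xs Q? = record
  { unique   = Unique.filter⁺ Q? (unique P-xs)
  ; sound    = λ x∈ → let (x∈xs , qx) = ∈-filter⁻ Q? x∈ in sound P-xs x∈xs , qx
  ; complete = λ (px , qx) → ∈-filter⁺ Q? (complete P-xs px) qx
  }

enumerates-upTo : ∀ n → Enumerates (_< n) (upTo n)
enumerates-upTo n = record { unique = Unique.upTo⁺ n ; sound = ∈-upTo⁻ ; complete = ∈-upTo⁺ }

length-filter-∁ : ∀ {A : Set} {P : A → Set} (P? : Decidable P) (xs : List A) →
  length (filter P? xs) + length (filter (¬? ∘ P?) xs) ≡ length xs
length-filter-∁ P? [] = refl
length-filter-∁ P? (x ∷ xs) with P? x
... | yes _ = cong suc (length-filter-∁ P? xs)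
... | no _  = trans (+-suc _ _) (cong suc (length-filter-∁ P? xs))

-- Σ-list _⊕_ ys xs lists x ⊕ y for x in xs and, for each such x, y in ys x.
-- With _⊕_ = _,_ it enumerates a dependent pair type; Defs.allVecs is the
-- instance _⊕_ = _∷_.
Σ-list : ∀ {A B C : Set} → (A → B → C) → (A → List B) → List A → List C
Σ-list _⊕_ ys xs = concatMap (λ x → map (x ⊕_) (ys x)) xs

module _ {A B C : Set} (_⊕_ : A → B → C) (ys : A → List B) where

  ∈-Σ-list⁺ : ∀ {xs x y} → x ∈ xs → y ∈ ys x → x ⊕ y ∈ Σ-list _⊕_ ys xs
  ∈-Σ-list⁺ {x ∷ _} (here refl) y∈ = ∈-++⁺ˡ (∈-map⁺ (x ⊕_) y∈)
  ∈-Σ-list⁺ {x ∷ _} (there x∈) y∈ = ∈-++⁺ʳ (map (x ⊕_) (ys x)) (∈-Σ-list⁺ x∈ y∈)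

  ∈-Σ-list⁻ : ∀ xs {z} → z ∈ Σ-list _⊕_ ys xs → ∃₂ λ x y → x ∈ xs × y ∈ ys x × z ≡ x ⊕ y
  ∈-Σ-list⁻ (x ∷ xs) z∈ with ∈-++⁻ (map (x ⊕_) (ys x)) z∈
  ... | inj₁ z∈x⊕ys = let (y , y∈ , z≡) = ∈-map⁻ (x ⊕_) z∈x⊕ys in x , y , here refl , y∈ , z≡
  ... | inj₂ z∈rest = let (x′ , y , x′∈ , y∈ , z≡) = ∈-Σ-list⁻ xs z∈rest in x′ , y , there x′∈ , y∈ , z≡

  Σ-list-unique : (∀ {x x′ y y′} → x ⊕ y ≡ x′ ⊕ y′ → x ≡ x′ × y ≡ y′) →
    ∀ {xs} → Unique xs → (∀ x → Unique (ys x)) → Unique (Σ-list _⊕_ ys xs)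
  Σ-list-unique ⊕-inj {[]} [] _ = []
  Σ-list-unique ⊕-inj {x ∷ xs} (x∉xs ∷ xs!) ys! =
    Unique.++⁺ (Unique.map⁺ (proj₂ ∘ ⊕-inj) (ys! x)) (Σ-list-unique ⊕-inj xs! ys!) disjoint
    where
    disjoint : ∀ {z} → z ∈ map (x ⊕_) (ys x) × z ∈ Σ-list _⊕_ ys xs → ⊥
    disjoint (z∈ , z∈rest) with ∈-map⁻ (x ⊕_) z∈ | ∈-Σ-list⁻ xs z∈rest
    ... | _ , _ , refl | x′ , _ , x′∈ , _ , e = All.lookup x∉xs x′∈ (proj₁ (⊕-inj e))

  length-Σ-list : ∀ xs → length (Σ-list _⊕_ ys xs) ≡ sum (map (length ∘ ys) xs)
  length-Σ-list [] = refl
  length-Σ-list (x ∷ xs) = trans (length-++ (map (x ⊕_) (ys x)))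
    (cong₂ _+_ (length-map (x ⊕_) (ys x)) (length-Σ-list xs))

enumerates-Σ : ∀ {A B : Set} {P : A → Set} {R : A → B → Set} {xs} {ys : A → List B} →
  Enumerates P xs → (∀ x → Enumerates (R x) (ys x)) →
  Enumerates (λ z → P (proj₁ z) × R (proj₁ z) (proj₂ z)) (Σ-list _,_ ys xs)
enumerates-Σ {P = P} {R} {xs} {ys} P-xs R-ys = record
  { unique   = Σ-list-unique _,_ ys (λ { refl → refl , refl }) (unique P-xs) (unique ∘ R-ys)
  ; sound    = λ z∈ → case-sound (∈-Σ-list⁻ _,_ ys xs z∈)
  ; complete = λ (px , rxy) → ∈-Σ-list⁺ _,_ ys (complete P-xs px) (complete (R-ys _) rxy)
  }
  where
  case-sound : ∀ {z} → (∃₂ λ x y → x ∈ xs × y ∈ ys x × z ≡ (x , y)) → P (proj₁ z) × R (proj₁ z) (proj₂ z)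
  case-sound (x , y , x∈ , y∈ , refl) = sound P-xs x∈ , sound (R-ys x) y∈

allVecs-unique : ∀ n k → Unique (allVecs n k)
allVecs-unique n zero = [] ∷ []
allVecs-unique n (suc k) = Σ-list-unique _∷_ (λ _ → allVecs n k) Vec.∷-injective (Unique.allFin⁺ n) (λ _ → allVecs-unique n k)

allVecs-complete : ∀ n k (v : Vec (Fin n) k) → v ∈ allVecs n k
allVecs-complete n zero [] = here refl
allVecs-complete n (suc k) (x ∷ v) = ∈-Σ-list⁺ _∷_ (λ _ → allVecs n k) (∈-allFin x) (allVecs-complete n k v)

enumerates-perms : ∀ n → Enumerates IsPerm (perms n)
enumerates-perms n = record
  { unique   = Unique.filter⁺ isPerm? (allVecs-unique n n)
  ; sound    = proj₂ ∘ ∈-filter⁻ isPerm? {xs = allVecs n n}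
  ; complete = ∈-filter⁺ isPerm? (allVecs-complete n n _)
  }

-- nth l i is the entry of l at position i (0 when i is out of range).
nth : List ℕ → ℕ → ℕ
nth [] _ = 0
nth (x ∷ _) zero = x
nth (_ ∷ l) (suc i) = nth l i

values : ∀ {m k} → Vec (Fin m) k → List ℕ
values [] = []
values (x ∷ v) = toℕ x ∷ values v

record IsPermList (m : ℕ) (l : List ℕ) : Set where
  constructor mkPermList
  field
    length≡  : length l ≡ m
    bounded  : All (_< m) l
    distinct : Unique l

length-values : ∀ {m k} (v : Vec (Fin m) k) → length (values v) ≡ k
length-values [] = refl
length-values (x ∷ v) = cong suc (length-values v)

nth-values : ∀ {m k} (v : Vec (Fin m) k) (a : Fin k) → nth (values v) (toℕ a) ≡ toℕ (lookup v a)
nth-values (x ∷ v) Fin.zero = refl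
nth-values (x ∷ v) (Fin.suc a) = nth-values v a

∈-values⁺ : ∀ {m k} (v : Vec (Fin m) k) (a : Fin k) → toℕ (lookup v a) ∈ values v
∈-values⁺ (x ∷ v) Fin.zero = here refl
∈-values⁺ (x ∷ v) (Fin.suc a) = there (∈-values⁺ v a)

∈-values⁻ : ∀ {m k y} (v : Vec (Fin m) k) → y ∈ values v → ∃ λ a → toℕ (lookup v a) ≡ y
∈-values⁻ (x ∷ v) (here refl) = Fin.zero , refl
∈-values⁻ (x ∷ v) (there y∈) = let (a , e) = ∈-values⁻ v y∈ in Fin.suc a , e

values-injective : ∀ {m k} (v w : Vec (Fin m) k) → values v ≡ values w → v ≡ w
values-injective [] [] _ = refl
values-injective (x ∷ v) (y ∷ w) e with ∷-injective e
... | x≡y , v≡w = cong₂ _∷_ (toℕ-injective x≡y) (values-injective v w v≡w)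

LookupInjective : ∀ {m k} → Vec (Fin m) k → Set
LookupInjective {k = k} v = ∀ (p q : Fin k) → lookup v p ≡ lookup v q → p ≡ q

lookupInjective⇒unique : ∀ {m k} (v : Vec (Fin m) k) → LookupInjective v → Unique (values v)
lookupInjective⇒unique [] _ = []
lookupInjective⇒unique (x ∷ v) inj =
  All.tabulate x∉v ∷ lookupInjective⇒unique v (λ p q e → Finₚ.suc-injective (inj (Fin.suc p) (Fin.suc q) e))
  where
  x∉v : ∀ {y} → y ∈ values v → toℕ x ≢ y
  x∉v y∈ x≡y with ∈-values⁻ v y∈
  ... | a , refl with inj Fin.zero (Fin.suc a) (toℕ-injective x≡y)
  ... | ()

unique⇒lookupInjective : ∀ {m k} (v : Vec (Fin m) k) → Unique (values v) → LookupInjective v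
unique⇒lookupInjective (x ∷ v) _ Fin.zero Fin.zero _ = refl
unique⇒lookupInjective (x ∷ v) (x∉v ∷ _) Fin.zero (Fin.suc q) x≡vq =
  ⊥-elim (All.lookup x∉v (∈-values⁺ v q) (cong toℕ x≡vq))
unique⇒lookupInjective (x ∷ v) (x∉v ∷ _) (Fin.suc p) Fin.zero vp≡x =
  ⊥-elim (All.lookup x∉v (∈-values⁺ v p) (cong toℕ (sym vp≡x)))
unique⇒lookupInjective (x ∷ v) (_ ∷ v!) (Fin.suc p) (Fin.suc q) vp≡vq =
  cong Fin.suc (unique⇒lookupInjective v v! p q vp≡vq)

fromValues : ∀ {m} (l : List ℕ) → All (_< m) l → Vec (Fin m) (length l)
fromValues [] [] = []
fromValues (x ∷ l) (x<m ∷ l<m) = fromℕ< x<m ∷ fromValues l l<m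

values-fromValues : ∀ {m} (l : List ℕ) (l<m : All (_< m) l) → values (fromValues l l<m) ≡ l
values-fromValues [] [] = refl
values-fromValues (x ∷ l) (x<m ∷ l<m) = cong₂ _∷_ (toℕ-fromℕ< x<m) (values-fromValues l l<m)

perm⇒permList : ∀ {m} (π : Vec (Fin m) m) → IsPerm π → IsPermList m (values π)
perm⇒permList π π-perm = mkPermList (length-values π) (values-bounded π) (lookupInjective⇒unique π π-perm)
  where
  values-bounded : ∀ {m k} (v : Vec (Fin m) k) → All (_< m) (values v)
  values-bounded [] = []
  values-bounded (x ∷ v) = toℕ<n x ∷ values-bounded v

permList⇒perm : ∀ {m l} → IsPermList m l → ∃ λ (π : Vec (Fin m) m) → IsPerm π × values π ≡ l
permList⇒perm {l = l} (mkPermList refl l<m l!) =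
  fromValues l l<m , unique⇒lookupInjective _ (subst Unique (sym values≡l) l!) , values≡l
  where
  values≡l : values (fromValues l l<m) ≡ l
  values≡l = values-fromValues l l<m

permLists : ℕ → List (List ℕ)
permLists m = map values (perms m)

enumerates-permLists : ∀ m → Enumerates (IsPermList m) (permLists m)
enumerates-permLists m = record
  { unique   = Unique.map⁺ (values-injective _ _) (unique (enumerates-perms m))
  ; sound    = sound′
  ; complete = complete′
  }
  where
  sound′ : ∀ {l} → l ∈ permLists m → IsPermList m l
  sound′ l∈ with ∈-map⁻ values l∈
  ... | π , π∈ , refl = perm⇒permList π (sound (enumerates-perms m) π∈)
  complete′ : ∀ {l} → IsPermList m l → l ∈ permLists m
  complete′ l-perm with permList⇒perm l-perm
  ... | π , π-perm , refl = ∈-map⁺ values (complete (enumerates-perms m) π-perm)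

-- ℕ-versions of Data.Fin's punchOut and punchIn: close, respectively open,
-- a gap at the value x.
punchOutℕ : ℕ → ℕ → ℕ
punchOutℕ x y with y <? x
... | yes _ = y
... | no _  = pred y

punchInℕ : ℕ → ℕ → ℕ
punchInℕ x y with y <? x
... | yes _ = y
... | no _  = suc y

punchOutℕ-punchInℕ : ∀ x y → punchOutℕ x (punchInℕ x y) ≡ y
punchOutℕ-punchInℕ x y with y <? x
... | yes y<x rewrite proj₂ (dec-yes (y <? x) y<x) = refl
... | no y≮x rewrite dec-no (suc y <? x) (y≮x ∘ <-trans (n<1+n y)) = refl

punchInℕ-punchOutℕ : ∀ x y → y ≢ x → punchInℕ x (punchOutℕ x y) ≡ y
punchInℕ-punchOutℕ x y y≢x with y <? x
... | yes y<x rewrite proj₂ (dec-yes (y <? x) y<x) = refl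
punchInℕ-punchOutℕ x zero y≢x | no 0≮x = ⊥-elim (0≮x (n≢0⇒n>0 (y≢x ∘ sym)))
punchInℕ-punchOutℕ x (suc y) y≢x | no 1+y≮x
  rewrite dec-no (y <? x) (λ y<x → y≢x (≤-antisym y<x (≮⇒≥ 1+y≮x))) = refl

punchInℕ-≢ : ∀ x y → punchInℕ x y ≢ x
punchInℕ-≢ x y with y <? x
... | yes y<x = <⇒≢ y<x
... | no y≮x  = λ 1+y≡x → y≮x (≤-reflexive 1+y≡x)

punchInℕ-< : ∀ {m} x y → x < suc m → y < m → punchInℕ x y < suc m
punchInℕ-< x y x≤m y<m with y <? x
... | yes _ = m<n⇒m<1+n y<m
... | no _  = s≤s y<m

punchOutℕ-< : ∀ {m} x y → x < suc m → y < suc m → y ≢ x → punchOutℕ x y < m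
punchOutℕ-< x y x≤m y≤m y≢x with y <? x
... | yes y<x = <-≤-trans y<x (s≤s⁻¹ x≤m)
punchOutℕ-< x zero x≤m y≤m y≢x | no 0≮x = ⊥-elim (0≮x (n≢0⇒n>0 (y≢x ∘ sym)))
punchOutℕ-< x (suc y) x≤m y≤m y≢x | no _ = s≤s⁻¹ y≤m

punchInℕ-injective : ∀ x {y z} → punchInℕ x y ≡ punchInℕ x z → y ≡ z
punchInℕ-injective x {y} {z} e =
  trans (sym (punchOutℕ-punchInℕ x y)) (trans (cong (punchOutℕ x) e) (punchOutℕ-punchInℕ x z))

-- A permutation list of length m+1 is its first entry x followed by a
-- permutation list of length m in which a gap has been opened at x.
splitHead : List ℕ → ℕ × List ℕ
splitHead [] = 0 , []
splitHead (x ∷ t) = x , map (punchOutℕ x) t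

joinHead : ℕ × List ℕ → List ℕ
joinHead (x , σ) = x ∷ map (punchInℕ x) σ

HeadTail : ℕ → ℕ × List ℕ → Set
HeadTail m (x , σ) = x < suc m × IsPermList m σ

splitHead-HeadTail : ∀ m {l} → IsPermList (suc m) l → HeadTail m (splitHead l)
splitHead-HeadTail m {x ∷ t} (mkPermList len (x≤m ∷ t≤m) (x∉t ∷ t!)) =
  x≤m , mkPermList (trans (length-map (punchOutℕ x) t) (suc-injective len))
                   (AllP.map⁺ (All.tabulate gap-bounded))
                   (map-unique (punchOutℕ x) t! gap-injective)
  where
  y≢x : ∀ {y} → y ∈ t → y ≢ x
  y≢x y∈t = (All.lookup x∉t y∈t) ∘ sym
  gap-bounded : ∀ {y} → y ∈ t → punchOutℕ x y < m
  gap-bounded y∈t = punchOutℕ-< x _ x≤m (All.lookup t≤m y∈t) (y≢x y∈t)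
  gap-injective : ∀ {a b} → a ∈ t → b ∈ t → punchOutℕ x a ≡ punchOutℕ x b → a ≡ b
  gap-injective a∈t b∈t e = trans (sym (punchInℕ-punchOutℕ x _ (y≢x a∈t)))
    (trans (cong (punchInℕ x) e) (punchInℕ-punchOutℕ x _ (y≢x b∈t)))

joinHead-IsPermList : ∀ m {z} → HeadTail m z → IsPermList (suc m) (joinHead z)
joinHead-IsPermList m {x , σ} (x≤m , mkPermList len σ<m σ!) =
  mkPermList (cong suc (trans (length-map (punchInℕ x) σ) len))
             (x≤m ∷ AllP.map⁺ (All.map (punchInℕ-< x _ x≤m) σ<m))
             (All.tabulate x∉ ∷ Unique.map⁺ (punchInℕ-injective x) σ!)
  where
  x∉ : ∀ {y} → y ∈ map (punchInℕ x) σ → x ≢ y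
  x∉ y∈ x≡y with ∈-map⁻ (punchInℕ x) y∈
  ... | z , _ , refl = punchInℕ-≢ x z (sym x≡y)

joinHead-splitHead : ∀ m {l} → IsPermList (suc m) l → joinHead (splitHead l) ≡ l
joinHead-splitHead m {x ∷ t} (mkPermList _ _ (x∉t ∷ _)) =
  cong (x ∷_) (trans (sym (map-∘ t)) (map-id-local (All.map (λ x≢y → punchInℕ-punchOutℕ x _ (x≢y ∘ sym)) x∉t)))

splitHead-joinHead : ∀ {z} → splitHead (joinHead z) ≡ z
splitHead-joinHead {x , σ} =
  cong (x ,_) (trans (sym (map-∘ σ)) (map-id-local (All.tabulate (λ {y} _ → punchOutℕ-punchInℕ x y))))

sum-map-const : ∀ {A : Set} (k : ℕ) (xs : List A) → sum (map (λ _ → k) xs) ≡ length xs * k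
sum-map-const k [] = refl
sum-map-const k (x ∷ xs) = cong (k +_) (sum-map-const k xs)

length-permLists : ∀ m → length (permLists m) ≡ m !
length-permLists zero = refl
length-permLists (suc m) = begin
  length (permLists (suc m))
    ≡⟨ enumerates-≡ (enumerates-permLists (suc m)) headTails splitHead joinHead
         (splitHead-HeadTail m) (joinHead-IsPermList m) (joinHead-splitHead m) (λ _ → splitHead-joinHead) ⟩
  length (Σ-list _,_ (λ _ → permLists m) (upTo (suc m)))
    ≡⟨ length-Σ-list _,_ (λ _ → permLists m) (upTo (suc m)) ⟩
  sum (map (λ _ → length (permLists m)) (upTo (suc m)))
    ≡⟨ sum-map-const (length (permLists m)) (upTo (suc m)) ⟩
  length (upTo (suc m)) * length (permLists m)
    ≡⟨ cong₂ _*_ (length-upTo (suc m)) (length-permLists m) ⟩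
  suc m * m ! ∎
  where
  open ≡-Reasoning
  headTails : Enumerates (HeadTail m) (Σ-list _,_ (λ _ → permLists m) (upTo (suc m)))
  headTails = enumerates-Σ (enumerates-upTo (suc m)) (λ _ → enumerates-permLists m)

Dominates : List ℕ → ℕ → Set
Dominates l p = (∀ {q} → q < p → nth l p < nth l q)
              × (∀ {q} → q < length l → p < q → nth l q < nth l p)

dominates? : ∀ l p → Dec (Dominates l p)
dominates? l p = allUpTo? (λ q → nth l p <? nth l q) p
           ×-dec allUpTo? (λ q → (p <? q) →-dec (nth l q <? nth l p)) (length l)

HasDominator : List ℕ → Set
HasDominator l = ∃ λ p → p < length l × Dominates l p

hasDominator? : ∀ l → Dec (HasDominator l)
hasDominator? l = anyUpTo? (dominates? l) (length l)

-- Domination in G_π, read off positions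

injective⇒surjective : ∀ {n} (f : Fin n → Fin n) → (∀ a b → f a ≡ f b → a ≡ b) → ∀ u → ∃ λ a → f a ≡ u
injective⇒surjective {suc n} f f-inj u with Finₚ.any? (λ a → f a Fin.≟ u)
... | yes hit = hit
... | no miss = ⊥-elim (collision (λ a u≡fa → miss (a , sym u≡fa)))
  where
  -- Missing u, f would squeeze Fin (suc n) into Fin n.
  collision : (∀ a → u ≢ f a) → ⊥
  collision u≢f with Finₚ.pigeonhole (n<1+n n) (λ a → Fin.punchOut (u≢f a))
  ... | i , j , i<j , eq = <-irrefl (cong toℕ (f-inj i j (Finₚ.punchOut-injective (u≢f i) (u≢f j) eq))) i<j

DominatesAt : ∀ {n} → Vec (Fin n) n → Fin n → Set
DominatesAt π a = (∀ b → toℕ b < toℕ a → toℕ (lookup π a) < toℕ (lookup π b))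
                × (∀ b → toℕ a < toℕ b → toℕ (lookup π b) < toℕ (lookup π a))

module _ {n} (π : Vec (Fin n) n) (π-perm : IsPerm π) where

  edge⇒inversion : ∀ a b → Edge π (lookup π a) (lookup π b) →
    (toℕ (lookup π a) < toℕ (lookup π b) × toℕ b < toℕ a) ⊎
    (toℕ (lookup π b) < toℕ (lookup π a) × toℕ a < toℕ b)
  edge⇒inversion a b (a′ , b′ , πa′≡πa , πb′≡πb , inversion)
    with refl ← π-perm a′ a πa′≡πa | refl ← π-perm b′ b πb′≡πb = inversion

  dominates1⇒dominatesAt : ∀ a → Dominates1 π (lookup π a) → DominatesAt π a
  dominates1⇒dominatesAt a dom = left , right
    where
    left : ∀ b → toℕ b < toℕ a → toℕ (lookup π a) < toℕ (lookup π b)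
    left b b<a with dom (lookup π b)
    ... | inj₁ πb≡πa = ⊥-elim (<-irrefl (cong toℕ (π-perm b a πb≡πa)) b<a)
    ... | inj₂ edge with edge⇒inversion a b edge
    ...   | inj₁ (πa<πb , _) = πa<πb
    ...   | inj₂ (_ , a<b)   = ⊥-elim (<-asym b<a a<b)
    right : ∀ b → toℕ a < toℕ b → toℕ (lookup π b) < toℕ (lookup π a)
    right b a<b with dom (lookup π b)
    ... | inj₁ πb≡πa = ⊥-elim (<-irrefl (cong toℕ (π-perm a b (sym πb≡πa))) a<b)
    ... | inj₂ edge with edge⇒inversion a b edge
    ...   | inj₁ (_ , b<a)   = ⊥-elim (<-asym a<b b<a)
    ...   | inj₂ (πb<πa , _) = πb<πa

  dominatesAt⇒dominates1 : ∀ a → DominatesAt π a → Dominates1 π (lookup π a)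
  dominatesAt⇒dominates1 a (left , right) u with injective⇒surjective (lookup π) π-perm u
  ... | b , refl with <-cmp (toℕ b) (toℕ a)
  ...   | tri< b<a _ _ = inj₂ (a , b , refl , refl , inj₁ (left b b<a , b<a))
  ...   | tri≈ _ b≡a _ = inj₁ (cong (lookup π) (toℕ-injective b≡a))
  ...   | tri> _ _ a<b = inj₂ (a , b , refl , refl , inj₂ (right b a<b , a<b))

  private
    nth-values-fromℕ< : ∀ {q} (q<n : q < n) → nth (values π) q ≡ toℕ (lookup π (fromℕ< q<n))
    nth-values-fromℕ< q<n = trans (cong (nth (values π)) (sym (toℕ-fromℕ< q<n))) (nth-values π (fromℕ< q<n))

  dominatesAt⇒dominates : ∀ a → DominatesAt π a → Dominates (values π) (toℕ a)
  dominatesAt⇒dominates a (left , right) = left′ , right′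
    where
    left′ : ∀ {q} → q < toℕ a → nth (values π) (toℕ a) < nth (values π) q
    left′ q<a = subst₂ _<_ (sym (nth-values π a)) (sym (nth-values-fromℕ< q<n))
      (left (fromℕ< q<n) (subst (_< toℕ a) (sym (toℕ-fromℕ< q<n)) q<a))
      where q<n = <-trans q<a (toℕ<n a)
    right′ : ∀ {q} → q < length (values π) → toℕ a < q → nth (values π) q < nth (values π) (toℕ a)
    right′ q<l a<q = subst₂ _<_ (sym (nth-values-fromℕ< q<n)) (sym (nth-values π a))
      (right (fromℕ< q<n) (subst (toℕ a <_) (sym (toℕ-fromℕ< q<n)) a<q))
      where q<n = subst (_ <_) (length-values π) q<l

  dominates⇒dominatesAt : ∀ a → Dominates (values π) (toℕ a) → DominatesAt π a
  dominates⇒dominatesAt a (left , right) =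
    (λ b b<a → subst₂ _<_ (nth-values π a) (nth-values π b) (left b<a)) ,
    (λ b a<b → subst₂ _<_ (nth-values π b) (nth-values π a)
                 (right (subst (toℕ b <_) (sym (length-values π)) (toℕ<n b)) a<b))

  gamma1⇒hasDominator : Gamma1 π → HasDominator (values π)
  gamma1⇒hasDominator (v , dom) with injective⇒surjective (lookup π) π-perm v
  ... | a , refl = toℕ a , subst (toℕ a <_) (sym (length-values π)) (toℕ<n a)
                 , dominatesAt⇒dominates a (dominates1⇒dominatesAt a dom)

  hasDominator⇒gamma1 : HasDominator (values π) → Gamma1 π
  hasDominator⇒gamma1 (p , p<l , dom) = lookup π a , dominatesAt⇒dominates1 a
    (dominates⇒dominatesAt a (subst (Dominates (values π)) (sym (toℕ-fromℕ< p<n)) dom))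
    where
    p<n = subst (p <_) (length-values π) p<l
    a = fromℕ< p<n

length-filter-map : ∀ {A B : Set} {P : A → Set} {Q : B → Set} (P? : Decidable P) (Q? : Decidable Q)
  (f : A → B) (xs : List A) → (∀ {x} → x ∈ xs → P x → Q (f x)) → (∀ {x} → x ∈ xs → Q (f x) → P x) →
  length (filter P? xs) ≡ length (filter Q? (map f xs))
length-filter-map P? Q? f [] _ _ = refl
length-filter-map P? Q? f (x ∷ xs) P⇒Q Q⇒P with P? x | Q? (f x)
... | yes _  | yes _   = cong suc (length-filter-map P? Q? f xs (P⇒Q ∘ there) (Q⇒P ∘ there))
... | no _   | no _    = length-filter-map P? Q? f xs (P⇒Q ∘ there) (Q⇒P ∘ there)
... | yes px | no ¬qfx = ⊥-elim (¬qfx (P⇒Q (here refl) px))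
... | no ¬px | yes qfx = ⊥-elim (¬px (Q⇒P (here refl) qfx))

g1≡count : ∀ n → g1 n ≡ length (filter hasDominator? (permLists n))
g1≡count n = length-filter-map gamma1? hasDominator? values (perms n)
  (λ {π} π∈ → gamma1⇒hasDominator π (sound (enumerates-perms n) π∈))
  (λ {π} π∈ → hasDominator⇒gamma1 π (sound (enumerates-perms n) π∈))

nth-∈ : ∀ (l : List ℕ) {i} → i < length l → nth l i ∈ l
nth-∈ (x ∷ l) {zero} _ = here refl
nth-∈ (x ∷ l) {suc i} (s≤s i<l) = there (nth-∈ l i<l)

nth-map : ∀ (f : ℕ → ℕ) (xs : List ℕ) {i} → i < length xs → nth (map f xs) i ≡ f (nth xs i)
nth-map f (x ∷ xs) {zero} _ = refl
nth-map f (x ∷ xs) {suc i} (s≤s i<xs) = nth-map f xs i<xs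

nth-++ˡ : ∀ (xs ys : List ℕ) {i} → i < length xs → nth (xs ++ ys) i ≡ nth xs i
nth-++ˡ (x ∷ xs) ys {zero} _ = refl
nth-++ˡ (x ∷ xs) ys {suc i} (s≤s i<xs) = nth-++ˡ xs ys i<xs

nth-++ʳ : ∀ (xs ys : List ℕ) i → nth (xs ++ ys) (length xs + i) ≡ nth ys i
nth-++ʳ [] ys i = refl
nth-++ʳ (x ∷ xs) ys i = nth-++ʳ xs ys i

take-nth-drop : ∀ (l : List ℕ) {p} → p < length l → take p l ++ nth l p ∷ drop (suc p) l ≡ l
take-nth-drop (x ∷ l) {zero} _ = refl
take-nth-drop (x ∷ l) {suc p} (s≤s p<l) = cong (x ∷_) (take-nth-drop l p<l)

take-++ : ∀ (xs ys : List ℕ) → take (length xs) (xs ++ ys) ≡ xs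
take-++ [] ys = refl
take-++ (x ∷ xs) ys = cong (x ∷_) (take-++ xs ys)

drop-++-∷ : ∀ (xs : List ℕ) y ys → drop (suc (length xs)) (xs ++ y ∷ ys) ≡ ys
drop-++-∷ [] y ys = refl
drop-++-∷ (x ∷ xs) y ys = drop-++-∷ xs y ys

length-take-< : ∀ (l : List ℕ) {p} → p < length l → length (take p l) ≡ p
length-take-< l {p} p<l = trans (length-take p l) (m≤n⇒m⊓n≡m (<⇒≤ p<l))

All-take⁺ : ∀ {P : ℕ → Set} (l : List ℕ) p → (∀ {q} → q < p → q < length l → P (nth l q)) → All P (take p l)
All-take⁺ l zero _ = []
All-take⁺ [] (suc p) _ = []
All-take⁺ (x ∷ l) (suc p) h = h (s≤s z≤n) (s≤s z≤n) ∷ All-take⁺ l p (λ q<p q<l → h (s≤s q<p) (s≤s q<l))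

All-drop⁺ : ∀ {P : ℕ → Set} (l : List ℕ) k → (∀ {q} → q < length l → k ≤ q → P (nth l q)) → All P (drop k l)
All-drop⁺ [] zero _ = []
All-drop⁺ [] (suc k) _ = []
All-drop⁺ (x ∷ l) zero h = h (s≤s z≤n) z≤n ∷ All-drop⁺ l zero (λ q<l _ → h (s≤s q<l) z≤n)
All-drop⁺ (x ∷ l) (suc k) h = All-drop⁺ l k (λ q<l k≤q → h (s≤s q<l) (s≤s k≤q))

unique-interval⇒length-≤ : ∀ {lo hi} (xs : List ℕ) → Unique xs → All (lo ≤_) xs → All (_< hi) xs →
  length xs ≤ hi ∸ lo
unique-interval⇒length-≤ {lo} {hi} xs xs! lo≤xs xs<hi = begin
  length xs                 ≡⟨ sym (length-map (_∸ lo) xs) ⟩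
  length (map (_∸ lo) xs)   ≤⟨ unique-⊆⇒length-≤ shifted! shifted⊆ ⟩
  length (upTo (hi ∸ lo))   ≡⟨ length-upTo (hi ∸ lo) ⟩
  hi ∸ lo                   ∎
  where
  open ≤-Reasoning
  shifted! : Unique (map (_∸ lo) xs)
  shifted! = map-unique (_∸ lo) xs! (λ a∈ b∈ → ∸-cancelʳ-≡ (All.lookup lo≤xs a∈) (All.lookup lo≤xs b∈))
  shifted⊆ : ∀ {y} → y ∈ map (_∸ lo) xs → y ∈ upTo (hi ∸ lo)
  shifted⊆ y∈ with ∈-map⁻ (_∸ lo) y∈
  ... | x , x∈ , refl = ∈-upTo⁺ (∸-monoˡ-< (All.lookup xs<hi x∈) (All.lookup lo≤xs x∈))

-- first P? k is the least i < k satisfying P, or k when there is none.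
first : ∀ {P : ℕ → Set} → Decidable P → ℕ → ℕ
first P? zero = zero
first P? (suc k) with P? zero
... | yes _ = zero
... | no _  = suc (first (P? ∘ suc) k)

first-minimal : ∀ {P : ℕ → Set} (P? : Decidable P) k {i} → i < first P? k → ¬ P i
first-minimal P? (suc k) {i} i<first with P? zero
first-minimal P? (suc k) {i} () | yes _
first-minimal P? (suc k) {zero} _ | no ¬P0 = ¬P0
first-minimal P? (suc k) {suc i} (s≤s i<first) | no _ = first-minimal (P? ∘ suc) k i<first

first-satisfies : ∀ {P : ℕ → Set} (P? : Decidable P) k {j} → j < k → P j → P (first P? k) × first P? k ≤ j
first-satisfies P? (suc k) {j} j<k Pj with P? zero
... | yes P0 = P0 , z≤n
first-satisfies P? (suc k) {zero} _ P0 | no ¬P0 = ⊥-elim (¬P0 P0)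
first-satisfies P? (suc k) {suc j} (s≤s j<k) Pj | no _ =
  let (P-first , first≤j) = first-satisfies (P? ∘ suc) k j<k Pj in P-first , s≤s first≤j

first-≡ : ∀ {P : ℕ → Set} (P? : Decidable P) k {j} → j < k → P j → (∀ {i} → i < j → ¬ P i) → first P? k ≡ j
first-≡ P? k j<k Pj j-least =
  let (P-first , first≤j) = first-satisfies P? k j<k Pj in
  ≤-antisym first≤j (≮⇒≥ (λ first<j → j-least first<j P-first))

-- In a permutation list of length n+1 the value at a dominating position p
-- is forced: the p larger entries before it and the n ∸ p smaller entries
-- after it leave no choice but n ∸ p.
dominator-value : ∀ {n l p} → IsPermList (suc n) l → p < length l → Dominates l p → nth l p ≡ n ∸ p
dominator-value {n} {l} {p} (mkPermList len l<N l!) p<l (left , right) = ≤-antisym x≤n∸p n∸p≤x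
  where
  x = nth l p
  x≤n : x ≤ n
  x≤n = s≤s⁻¹ (All.lookup l<N (nth-∈ l p<l))
  -- the entries before p are distinct values in (x, n]
  p≤n∸x : p ≤ n ∸ x
  p≤n∸x = subst (_≤ n ∸ x) (length-take-< l p<l)
    (unique-interval⇒length-≤ (take p l) (Unique.take⁺ p l!) (All-take⁺ l p (λ q<p _ → left q<p)) (AllP.take⁺ p l<N))
  -- the entries after p are distinct values in [0, x)
  n∸p≤x : n ∸ p ≤ x
  n∸p≤x = subst (_≤ x) (trans (length-drop (suc p) l) (cong (_∸ suc p) len))
    (unique-interval⇒length-≤ (drop (suc p) l) (Unique.drop⁺ (suc p) l!)
       (All.tabulate (λ _ → z≤n)) (All-drop⁺ l (suc p) right))
  x≤n∸p : x ≤ n ∸ p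
  x≤n∸p = m+n≤o⇒m≤o∸n x (begin
    x + p     ≡⟨ +-comm x p ⟩
    p + x     ≤⟨ +-monoˡ-≤ x p≤n∸x ⟩
    n ∸ x + x ≡⟨ m∸n+n≡m x≤n ⟩
    n         ∎)
    where open ≤-Reasoning

module Assembled (a c : List ℕ) (r : ℕ) (c<r : All (_< r) c) where

  raise : ℕ → ℕ
  raise y = y + suc r

  list : List ℕ
  list = map raise a ++ r ∷ c

  length-list : length list ≡ length a + suc (length c)
  length-list = trans (length-++ (map raise a)) (cong (_+ suc (length c)) (length-map raise a))

  nth-before : ∀ {j} → j < length a → nth list j ≡ raise (nth a j)
  nth-before j<a = trans (nth-++ˡ (map raise a) (r ∷ c) (subst (_ <_) (sym (length-map raise a)) j<a))
                         (nth-map raise a j<a)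

  nth-at : nth list (length a) ≡ r
  nth-at = trans (cong (nth list) (sym (trans (+-identityʳ _) (length-map raise a))))
                 (nth-++ʳ (map raise a) (r ∷ c) 0)

  nth-after : ∀ {q} → length a < q → q < length list → nth list q < r
  nth-after {q} a<q q<list = subst (_< r) (sym nth-q≡) (All.lookup c<r (nth-∈ c j<c))
    where
    j = q ∸ suc (length a)
    q≡ : length (map raise a) + suc j ≡ q
    q≡ = trans (cong (_+ suc j) (length-map raise a)) (trans (+-suc (length a) j) (m+[n∸m]≡n a<q))
    nth-q≡ : nth list q ≡ nth c j
    nth-q≡ = trans (cong (nth list) (sym q≡)) (nth-++ʳ (map raise a) (r ∷ c) (suc j))
    j<c : j < length c
    j<c = s≤s⁻¹ (+-cancelˡ-< (length a) _ _ (subst₂ _<_ (trans (sym q≡) (cong (_+ suc j) (length-map raise a))) length-list q<list))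

  below-raised : ∀ y → r < raise y
  below-raised y = m≤n+m (suc r) y

  dominates-at : Dominates list (length a)
  dominates-at =
    (λ q<a → subst₂ _<_ (sym nth-at) (sym (nth-before q<a)) (below-raised _)) ,
    (λ q<list a<q → subst (nth list _ <_) (sym nth-at) (nth-after a<q q<list))

  dominates-before⁺ : ∀ {i} → i < length a → Dominates a i → Dominates list i
  dominates-before⁺ {i} i<a (left , right) = left′ , right′
    where
    left′ : ∀ {q} → q < i → nth list i < nth list q
    left′ q<i = subst₂ _<_ (sym (nth-before i<a)) (sym (nth-before (<-trans q<i i<a)))
                  (+-monoˡ-< (suc r) (left q<i))
    right′ : ∀ {q} → q < length list → i < q → nth list q < nth list i
    right′ {q} q<list i<q with <-cmp q (length a)
    ... | tri< q<a _ _ = subst₂ _<_ (sym (nth-before q<a)) (sym (nth-before i<a))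
                           (+-monoˡ-< (suc r) (right q<a i<q))
    ... | tri≈ _ refl _ = subst₂ _<_ (sym nth-at) (sym (nth-before i<a)) (below-raised _)
    ... | tri> _ _ a<q = subst (nth list q <_) (sym (nth-before i<a))
                           (<-trans (nth-after a<q q<list) (below-raised _))

  dominates-before⁻ : ∀ {i} → i < length a → Dominates list i → Dominates a i
  dominates-before⁻ {i} i<a (left , right) = left′ , right′
    where
    left′ : ∀ {q} → q < i → nth a i < nth a q
    left′ q<i = +-cancelʳ-< (suc r) _ _
      (subst₂ _<_ (nth-before i<a) (nth-before (<-trans q<i i<a)) (left q<i))
    right′ : ∀ {q} → q < length a → i < q → nth a q < nth a i
    right′ q<a i<q = +-cancelʳ-< (suc r) _ _
      (subst₂ _<_ (nth-before q<a) (nth-before i<a)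
        (right (subst (_ <_) (sym length-list) (<-≤-trans q<a (m≤m+n (length a) _))) i<q))

-- Decomposition at the first dominating position

module Decomposition (n : ℕ) where

  -- A permutation list of length n+1 whose first dominating position is p
  -- is determined by the entries before p (lowered, a permutation list of
  -- length p without a dominating position) and the entries after p (a
  -- permutation list of length n ∸ p).
  Pieces : ℕ × (List ℕ × List ℕ) → Set
  Pieces (p , a , c) = p < suc n × (IsPermList p a × ¬ HasDominator a) × IsPermList (n ∸ p) c

  assemble : ℕ × (List ℕ × List ℕ) → List ℕ
  assemble (p , a , c) = map (_+ suc (n ∸ p)) a ++ (n ∸ p) ∷ c

  cutAt : ℕ → List ℕ → ℕ × (List ℕ × List ℕ)
  cutAt p l = p , map (_∸ suc (n ∸ p)) (take p l) , drop (suc p) l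

  firstDominator : List ℕ → ℕ
  firstDominator l = first (dominates? l) (suc n)

  disassemble : List ℕ → ℕ × (List ℕ × List ℕ)
  disassemble l = cutAt (firstDominator l) l

  assemble-cutAt : ∀ {l p} → IsPermList (suc n) l → p < length l → Dominates l p → assemble (cutAt p l) ≡ l
  assemble-cutAt {l} {p} l-perm p<l dom@(left , _) = begin
    map (_+ s) (map (_∸ s) (take p l)) ++ n ∸ p ∷ drop (suc p) l
      ≡⟨ cong₂ (λ t x → t ++ x ∷ drop (suc p) l) restore (sym x≡) ⟩
    take p l ++ nth l p ∷ drop (suc p) l
      ≡⟨ take-nth-drop l p<l ⟩
    l ∎
    where
    open ≡-Reasoning
    s = suc (n ∸ p)
    x≡ : nth l p ≡ n ∸ p
    x≡ = dominator-value l-perm p<l dom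
    before>x : All (n ∸ p <_) (take p l)
    before>x = All-take⁺ l p (λ {q} q<p _ → subst (_< nth l q) x≡ (left q<p))
    restore : map (_+ s) (map (_∸ s) (take p l)) ≡ take p l
    restore = trans (sym (map-∘ (take p l))) (map-id-local (All.map m∸n+n≡m before>x))

  disassemble-Pieces : ∀ {l} → IsPermList (suc n) l × HasDominator l → Pieces (disassemble l)
  disassemble-Pieces {l} (l-perm@(mkPermList len l<N l!) , j , j<l , dom-j) =
    p<N , (a-perm , a-free) , c-perm
    where
    p = firstDominator l
    r = n ∸ p
    j<N = subst (j <_) len j<l
    dom-p = proj₁ (first-satisfies (dominates? l) (suc n) j<N dom-j)
    p<N = ≤-<-trans (proj₂ (first-satisfies (dominates? l) (suc n) j<N dom-j)) j<N
    p<l = subst (p <_) (sym len) p<N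
    x≡ : nth l p ≡ r
    x≡ = dominator-value l-perm p<l dom-p
    t = take p l
    a = map (_∸ suc r) t
    c = drop (suc p) l
    t>r : All (r <_) t
    t>r = All-take⁺ l p (λ {q} q<p _ → subst (_< nth l q) x≡ (proj₁ dom-p q<p))
    c<r : All (_< r) c
    c<r = All-drop⁺ l (suc p) (λ {q} q<l p<q → subst (nth l q <_) x≡ (proj₂ dom-p q<l p<q))
    a-perm : IsPermList p a
    a-perm = mkPermList (trans (length-map (_∸ suc r) t) (length-take-< l p<l))
      (AllP.map⁺ (All.zipWith (λ {y} (y<N , r<y) → subst (y ∸ suc r <_) (m∸[m∸n]≡n (s≤s⁻¹ p<N)) (∸-monoˡ-< y<N r<y))
                              (AllP.take⁺ p l<N , t>r)))
      (map-unique (_∸ suc r) (Unique.take⁺ p l!) (λ a∈ b∈ → ∸-cancelʳ-≡ (All.lookup t>r a∈) (All.lookup t>r b∈)))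
    a-free : ¬ HasDominator a
    a-free (i , i<a , dom-a) = first-minimal (dominates? l) (suc n) i<p
      (subst (λ l′ → Dominates l′ i) (assemble-cutAt l-perm p<l dom-p) (dominates-before⁺ i<a dom-a))
      where
      open Assembled a c r c<r using (dominates-before⁺)
      i<p = subst (i <_) (IsPermList.length≡ a-perm) i<a
    c-perm : IsPermList r c
    c-perm = mkPermList (trans (length-drop (suc p) l) (cong (_∸ suc p) len)) c<r (Unique.drop⁺ (suc p) l!)

  assemble-IsPermList : ∀ {z} → Pieces z → IsPermList (suc n) (assemble z) × HasDominator (assemble z)
  assemble-IsPermList {p , a , c} (p<N , (mkPermList refl a<p a! , _) , mkPermList c-len c<r c!) =
    mkPermList list-len list<N list! , p , subst (p <_) (sym list-len) p<N , dominates-at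
    where
    r = n ∸ p
    open Assembled a c r c<r
    N≡ : p + suc r ≡ suc n
    N≡ = trans (+-suc p r) (cong suc (m+[n∸m]≡n (s≤s⁻¹ p<N)))
    r<N : r < suc n
    r<N = subst (r <_) N≡ (m≤n+m (suc r) p)
    list-len : length list ≡ suc n
    list-len = trans length-list (trans (cong (λ k → p + suc k) c-len) N≡)
    list<N : All (_< suc n) list
    list<N = AllP.++⁺ (AllP.map⁺ (All.map (λ {y} y<p → subst (raise y <_) N≡ (+-monoˡ-< (suc r) y<p)) a<p))
                      (r<N ∷ All.map (λ y<r → <-trans y<r r<N) c<r)
    list! : Unique list
    list! = Unique.++⁺ (Unique.map⁺ (λ {x} {y} → +-cancelʳ-≡ (suc r) x y) a!)
                       (All.map (λ y<r r≡y → <-irrefl (sym r≡y) y<r) c<r ∷ c!)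
                       raised∉
      where
      raised∉ : ∀ {z} → z ∈ map raise a × z ∈ r ∷ c → ⊥
      raised∉ (z∈a↑ , z∈rc) with ∈-map⁻ raise z∈a↑
      ... | y , _ , refl with z∈rc
      ...   | here e = <-irrefl (sym e) (below-raised y)
      ...   | there z∈c = <-asym (All.lookup c<r z∈c) (below-raised y)

  assemble-disassemble : ∀ {l} → IsPermList (suc n) l × HasDominator l → assemble (disassemble l) ≡ l
  assemble-disassemble {l} (l-perm@(mkPermList len _ _) , j , j<l , dom-j) =
    assemble-cutAt l-perm (subst (firstDominator l <_) (sym len) p<N) dom-p
    where
    j<N = subst (j <_) len j<l
    dom-p = proj₁ (first-satisfies (dominates? l) (suc n) j<N dom-j)
    p<N = ≤-<-trans (proj₂ (first-satisfies (dominates? l) (suc n) j<N dom-j)) j<N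

  disassemble-assemble : ∀ {z} → Pieces z → disassemble (assemble z) ≡ z
  disassemble-assemble {p , a , c} (p<N , (mkPermList refl _ _ , a-free) , c-perm) = begin
    cutAt (firstDominator list) list ≡⟨ cong (λ k → cutAt k list) first≡p ⟩
    cutAt p list                     ≡⟨ cong₂ (λ t d → p , t , d) lowered dropped ⟩
    (p , a , c)                      ∎
    where
    open ≡-Reasoning
    r = n ∸ p
    open Assembled a c r (IsPermList.bounded c-perm)
    first≡p : firstDominator list ≡ p
    first≡p = first-≡ (dominates? list) (suc n) p<N dominates-at
      (λ i<p dom-i → a-free (_ , i<p , dominates-before⁻ i<p dom-i))
    p≡ : length (map raise a) ≡ p
    p≡ = length-map raise a
    lowered : map (_∸ suc r) (take p list) ≡ a
    lowered = trans (cong (λ k → map (_∸ suc r) (take k list)) (sym p≡))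
      (trans (cong (map (_∸ suc r)) (take-++ (map raise a) (r ∷ c)))
      (trans (sym (map-∘ a)) (map-id-local (All.tabulate (λ {y} _ → m+n∸n≡m y (suc r))))))
    dropped : drop (suc p) list ≡ c
    dropped = trans (cong (λ k → drop (suc k) list) (sym p≡)) (drop-++-∷ (map raise a) r c)

noDominator? : ∀ l → Dec (¬ HasDominator l)
noDominator? = ¬? ∘ hasDominator?

f10≡count : ∀ m → f10 m ≡ length (filter noDominator? (permLists m))
f10≡count m = begin
  m ! ∸ g1 m                       ≡⟨ cong₂ _∸_ (sym (length-permLists m)) (g1≡count m) ⟩
  length (permLists m) ∸ dominated ≡⟨ cong (_∸ dominated) (sym (length-filter-∁ hasDominator? (permLists m))) ⟩
  dominated + free ∸ dominated     ≡⟨ m+n∸m≡n dominated free ⟩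
  free                             ∎
  where
  open ≡-Reasoning
  dominated = length (filter hasDominator? (permLists m))
  free = length (filter noDominator? (permLists m))

-- Classifying by the first dominating position p = k - 1, its pieces range
-- over f(k-1,1,0) permutations before p and (n+1-k)! permutations after p.
g1-recurrence : ∀ n → g1 (suc n) ≡ rhs (suc n)
g1-recurrence n = begin
  g1 (suc n)                                         ≡⟨ g1≡count (suc n) ⟩
  length (filter hasDominator? (permLists (suc n)))  ≡⟨ bijection ⟩
  length (Σ-list _,_ pieceLists (upTo (suc n)))      ≡⟨ length-Σ-list _,_ pieceLists (upTo (suc n)) ⟩
  sum (map (length ∘ pieceLists) (upTo (suc n)))     ≡⟨ cong sum (map-cong pieceCount (upTo (suc n))) ⟩
  rhs (suc n)                                        ∎
  where
  open ≡-Reasoning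
  open Decomposition n
  pieceLists : ℕ → List (List ℕ × List ℕ)
  pieceLists p = Σ-list _,_ (λ _ → permLists (n ∸ p)) (filter noDominator? (permLists p))

  pieces : Enumerates Pieces (Σ-list _,_ pieceLists (upTo (suc n)))
  pieces = enumerates-Σ (enumerates-upTo (suc n)) λ p →
    enumerates-Σ (enumerates-filter (enumerates-permLists p) noDominator?) (λ _ → enumerates-permLists (n ∸ p))

  bijection : length (filter hasDominator? (permLists (suc n))) ≡ length (Σ-list _,_ pieceLists (upTo (suc n)))
  bijection = enumerates-≡ (enumerates-filter (enumerates-permLists (suc n)) hasDominator?) pieces
    disassemble assemble disassemble-Pieces assemble-IsPermList assemble-disassemble disassemble-assemble

  pieceCount : ∀ p → length (pieceLists p) ≡ (n ∸ p) ! * f10 p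
  pieceCount p = begin
    length (pieceLists p)                                          ≡⟨ length-Σ-list _,_ (λ _ → permLists (n ∸ p)) free ⟩
    sum (map (λ _ → length (permLists (n ∸ p))) free)              ≡⟨ sum-map-const _ free ⟩
    length free * length (permLists (n ∸ p))                       ≡⟨ cong₂ _*_ (sym (f10≡count p)) (length-permLists (n ∸ p)) ⟩
    f10 p * (n ∸ p) !                                              ≡⟨ *-comm (f10 p) ((n ∸ p) !) ⟩
    (n ∸ p) ! * f10 p                                              ∎
    where
    free = filter noDominator? (permLists p)

theorem1 : (g1 0 ≡ 0) × (∀ (n : ℕ) → g1 (suc n) ≡ rhs (suc n))
theorem1 = refl , g1-recurrence
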